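{- Let $R$ be a 2-ring and let $R[X]$ be its 2-ring of multipolynomials in one variable. Then $R[X]$ is a 2-domain if and only if $R$ is a 2-domain.
   Context: A multioperation on a set $S$ is a map $S\times S\to\mathcal P^*(S)$, where $\mathcal P^*(S)$ is the set of nonempty subsets of $S$. Multioperations extend to subsets: for $A,B\subseteq S$ set $A+B=\bigcup_{a\in A,b\in B}(a+b)$, similarly $A\cdot B$, and $-A=\{ -a:a\in A\}$; an element $a$ is identified with $\{a\}$. A 2-ring (superring) is a structure $(S,+,\cdot,-,0,1)$ with $+,\cdot$ multioperations, $-:S\to S$ a function and $0,1\in S$ such that for all $a,b,c\in S$: (1) $(S,+,-,0)$ is a commutative multigroup: $c\in a+b$ implies $a\in c+(-b)$ and $b\in(-a)+c$; $a+0=\{a\}$; $(a+b)+c=a+(b+c)$ as sets; $a+b=b+a$; (2) $(S,\cdot,1)$ is a commutative multimonoid: $1\cdot a=\{a\}$, $(a\cdot b)\cdot c=a\cdot(b\cdot c)$ and $a\cdot b=b\cdot a$ as sets; (3) $a\cdot 0=\{0\}$; (4) weak distributivity: $c\cdot(a+b)\subseteq c\cdot a+c\cdot b$; (5) rule of signs: $-(a\cdot b)=(-a)\cdot b=a\cdot(-b)$. A 2-domain is a 2-ring with $0\neq 1$ such that for all $a,b$: $0\in a\cdot b$ iff $a=0$ or $b=0$. Finite sums: $x\in\sum_{i<0}a_i$ iff $x=0$, and $x\in\sum_{i<p}a_i$ iff $x\in y+a_{p-1}$ for some $y\in\sum_{i<p-1}a_i$; sums of sets of the form $a_ib_j$ are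 taken via the extension to subsets. For a 2-ring $R$, $R[X]$ is the set of sequences $(a_n)_{n\in\omega}$ of elements of $R$ that are eventually $0$, with: $(c_n)\in(a_n)+(b_n)$ iff $c_n\in a_n+b_n$ for all $n$; $(c_n)\in(a_n)\cdot(b_n)$ iff for all $n$, $c_n\in a_0b_n+a_1b_{n-1}+\dots+a_nb_0$; $-(a_n)=(-a_n)$; $0=(0,0,\dots)$; $1=(1,0,0,\dots)$. This is again a 2-ring. -}

module Defs where

open import Data.Nat using (ℕ; zero; suc; _∸_; _≤_)
open import Data.Product using (Σ; ∃; _×_; _,_)
open import Data.Sum using (_⊎_)
open import Relation.Nullary using (¬_)
open import Relation.Binary.PropositionalEquality using (_≡_)

Subset : Set → Set₁
Subset S = S → Set

_≐_ : {S : Set} → Subset S → Subset S → Set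
A ≐ B = (∀ x → A x → B x) × (∀ x → B x → A x)

_⊆_ : {S : Set} → Subset S → Subset S → Set
A ⊆ B = ∀ x → A x → B x

⟦_⟧ : {S : Set} → S → Subset S
⟦ a ⟧ x = x ≡ a

-- a multioperation S × S → P*(S), given as a ternary relation "c ∈ a ∘ b"
MultiOp : Set → Set₁
MultiOp S = S → S → Subset S

lift : {S : Set} → MultiOp S → Subset S → Subset S → Subset S
lift op A B x = Σ _ λ a → Σ _ λ b → A a × B b × op a b x

image : {S : Set} → (S → S) → Subset S → Subset S
image f A x = Σ _ λ y → A y × x ≡ f y

record TwoRing : Set₁ where
  field
    S    : Set
    add  : MultiOp S          -- add a b c  means  c ∈ a + b
    mul  : MultiOp S          -- mul a b c  means  c ∈ a · b
    neg  : S → S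
    zero₀ : S
    one  : S
    add-nonempty : ∀ a b → ∃ λ c → add a b c
    mul-nonempty : ∀ a b → ∃ λ c → mul a b c
    add-rev₁ : ∀ a b c → add a b c → add c (neg b) a
    add-rev₂ : ∀ a b c → add a b c → add (neg a) c b
    add-zero : ∀ a → add a zero₀ ≐ ⟦ a ⟧
    add-assoc : ∀ a b c → lift add (add a b) ⟦ c ⟧ ≐ lift add ⟦ a ⟧ (add b c)
    add-comm : ∀ a b → add a b ≐ add b a
    mul-one : ∀ a → mul one a ≐ ⟦ a ⟧
    mul-assoc : ∀ a b c → lift mul (mul a b) ⟦ c ⟧ ≐ lift mul ⟦ a ⟧ (mul b c)
    mul-comm : ∀ a b → mul a b ≐ mul b a
    mul-zero : ∀ a → mul a zero₀ ≐ ⟦ zero₀ ⟧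
    distrib : ∀ a b c → lift mul ⟦ c ⟧ (add a b) ⊆ lift add (mul c a) (mul c b)
    sign₁ : ∀ a b → image neg (mul a b) ≐ mul (neg a) b
    sign₂ : ∀ a b → image neg (mul a b) ≐ mul a (neg b)

module _ (R : TwoRing) where
  open TwoRing R

  IsTwoDomain : Set
  IsTwoDomain = ¬ (zero₀ ≡ one)
              × (∀ a b → (mul a b zero₀ → (a ≡ zero₀ ⊎ b ≡ zero₀))
                       × ((a ≡ zero₀ ⊎ b ≡ zero₀) → mul a b zero₀))

  Poly : Set
  Poly = Σ (ℕ → S) λ f → Σ ℕ λ N → ∀ n → N ≤ n → f n ≡ zero₀

  coeff : Poly → ℕ → S
  coeff (f , _) = f

  _≈ₚ_ : Poly → Poly → Set
  p ≈ₚ q = ∀ n → coeff p n ≡ coeff q n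

  zeroP : Poly
  zeroP = (λ _ → zero₀) , 0 , λ _ _ → Relation.Binary.PropositionalEquality.refl

  oneP : Poly
  oneP = f , 1 , ev
    where
    f : ℕ → S
    f zero = one
    f (suc _) = zero₀
    ev : ∀ n → 1 ≤ n → f n ≡ zero₀
    ev (suc n) _ = Relation.Binary.PropositionalEquality.refl

  convSum : (ℕ → S) → (ℕ → S) → ℕ → ℕ → Subset S
  convSum a b n zero x = x ≡ zero₀
  convSum a b n (suc p) x = lift add (convSum a b n p) (mul (a p) (b (n ∸ p))) x

  -- r ∈ p · q  in R[X]
  mulP : Poly → Poly → Poly → Set
  mulP p q r = ∀ n → convSum (coeff p) (coeff q) n (suc n) (coeff r n)

  PolyIsTwoDomain : Set
  PolyIsTwoDomain = ¬ (zeroP ≈ₚ oneP)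
                  × (∀ p q → (mulP p q zeroP → (p ≈ₚ zeroP ⊎ q ≈ₚ zeroP))
                           × ((p ≈ₚ zeroP ⊎ q ≈ₚ zeroP) → mulP p q zeroP))

{-# OPTIONS --safe #-}
module Submission where

open import Defs
open import Data.Empty using (⊥-elim)
open import Data.Nat using (ℕ; zero; suc; _+_; _∸_; _≤_; _<_; z≤n; s≤s)
open import Data.Nat.Properties
  using (≤-refl; ≤-trans; n≤1+n; m≤n⇒m<n∨m≡n; m+n∸m≡n; m≤m+n; ∸-monoʳ-<; <-cmp; <⇒≢; >⇒≢)
open import Data.Product using (_×_; _,_; proj₁; proj₂)
open import Data.Sum using (_⊎_; inj₁; inj₂)
open import Function.Bundles using (_⇔_; mk⇔; Equivalence)
open import Relation.Binary using (tri<; tri≈; tri>)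
open import Relation.Binary.PropositionalEquality

-- If p and q have degrees at most N and M, every element of the (N+M)-th
-- coefficient set of p·q lies in p_N·q_M, since all other summands are {0}.
-- In a 2-domain 0 ∈ p_N·q_M forces p_N = 0 or q_M = 0, so a zero product lets
-- one degree bound drop; iterating, one of p, q vanishes.  Conversely R embeds
-- in R[X] as the constants.

module _ (R : TwoRing) where
  open TwoRing R

  ∈+0⇒≡ : ∀ {a x} → add a zero₀ x → x ≡ a
  ∈+0⇒≡ {a} {x} = proj₁ (add-zero a) x

  ∈0+⇒≡ : ∀ {a x} → add zero₀ a x → x ≡ a
  ∈0+⇒≡ {a} {x} h = ∈+0⇒≡ (proj₁ (add-comm zero₀ a) x h)

  0∈0+0 : add zero₀ zero₀ zero₀
  0∈0+0 = proj₂ (add-zero zero₀) zero₀ refl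

  ∈·0⇒≡0 : ∀ {a x} → mul a zero₀ x → x ≡ zero₀
  ∈·0⇒≡0 {a} {x} = proj₁ (mul-zero a) x

  ∈0·⇒≡0 : ∀ {a x} → mul zero₀ a x → x ≡ zero₀
  ∈0·⇒≡0 {a} {x} h = ∈·0⇒≡0 (proj₁ (mul-comm zero₀ a) x h)

  0∈·0 : ∀ a → mul a zero₀ zero₀
  0∈·0 a = proj₂ (mul-zero a) zero₀ refl

  0∈0· : ∀ a → mul zero₀ a zero₀
  0∈0· a = proj₁ (mul-comm a zero₀) zero₀ (0∈·0 a)

  module Convolution (a b : ℕ → S) (n : ℕ) where

    term : ℕ → Subset S
    term i = mul (a i) (b (n ∸ i))

    0∈convSum : ∀ k → (∀ i → term i zero₀) → convSum R a b n k zero₀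
    0∈convSum zero    h = refl
    0∈convSum (suc k) h = zero₀ , zero₀ , 0∈convSum k h , h k , 0∈0+0

    convSum⊆0 : ∀ k → (∀ i → i < k → term i ⊆ ⟦ zero₀ ⟧) → convSum R a b n k ⊆ ⟦ zero₀ ⟧
    convSum⊆0 zero    h x x≡0 = x≡0
    convSum⊆0 (suc k) h x (y , z , y∈ , z∈ , x∈y+z)
      rewrite convSum⊆0 k (λ i i<k → h i (≤-trans i<k (n≤1+n k))) y y∈
            | h k ≤-refl z z∈
      = ∈+0⇒≡ x∈y+z

    convSum⊆single : ∀ m → (∀ i → i ≢ m → term i ⊆ ⟦ zero₀ ⟧)
                   → ∀ k → m < k → convSum R a b n k ⊆ term m
    convSum⊆single m h (suc k) (s≤s m≤k) x (y , z , y∈ , z∈ , x∈y+z)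
      with m≤n⇒m<n∨m≡n m≤k
    ... | inj₂ refl
      rewrite convSum⊆0 m (λ i i<m → h i (<⇒≢ i<m)) y y∈
      = subst (term m) (sym (∈0+⇒≡ x∈y+z)) z∈
    ... | inj₁ m<k
      rewrite h k (>⇒≢ m<k) z z∈
      = subst (term m) (sym (∈+0⇒≡ x∈y+z)) (convSum⊆single m h k m<k y y∈)

  BoundedBy : (ℕ → S) → ℕ → Set
  BoundedBy f N = ∀ n → N ≤ n → f n ≡ zero₀

  boundedBy-pred : ∀ {f N} → BoundedBy f (suc N) → f N ≡ zero₀ → BoundedBy f N
  boundedBy-pred bound fN≡0 n N≤n with m≤n⇒m<n∨m≡n N≤n
  ... | inj₁ N<n = bound n N<n
  ... | inj₂ refl = fN≡0

  leadingCoefficients : ∀ {f g} N M → BoundedBy f (suc N) → BoundedBy g (suc M)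
                      → convSum R f g (N + M) (suc (N + M)) ⊆ mul (f N) (g M)
  leadingCoefficients {f} {g} N M bf bg x x∈ =
    subst (λ j → mul (f N) (g j) x) (m+n∸m≡n N M)
      (convSum⊆single N others (suc (N + M)) (s≤s (m≤m+n N M)) x x∈)
    where
    open Convolution f g (N + M)
    others : ∀ i → i ≢ N → term i ⊆ ⟦ zero₀ ⟧
    others i i≢N z z∈ with <-cmp i N
    ... | tri< i<N _ _ =
      ∈·0⇒≡0 (subst (λ w → mul (f i) w z)
        (bg _ (subst (λ j → suc j ≤ N + M ∸ i) (m+n∸m≡n N M) (∸-monoʳ-< i<N (m≤m+n N M))))
        z∈)
    ... | tri≈ _ i≡N _ = ⊥-elim (i≢N i≡N)
    ... | tri> _ _ N<i = ∈0·⇒≡0 (subst (λ w → mul w (g (N + M ∸ i)) z) (bf i N<i) z∈)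

  zeroProduct⇒zeroFactor : (∀ a b → mul a b zero₀ → a ≡ zero₀ ⊎ b ≡ zero₀)
              → ∀ {f g} N M → BoundedBy f N → BoundedBy g M
              → (∀ n → convSum R f g n (suc n) zero₀)
              → (∀ n → f n ≡ zero₀) ⊎ (∀ n → g n ≡ zero₀)
  zeroProduct⇒zeroFactor dom zero    M       bf bg h = inj₁ (λ n → bf n z≤n)
  zeroProduct⇒zeroFactor dom (suc N) zero    bf bg h = inj₂ (λ n → bg n z≤n)
  zeroProduct⇒zeroFactor dom {f} {g} (suc N) (suc M) bf bg h
    with dom (f N) (g M) (leadingCoefficients N M bf bg zero₀ (h (N + M)))
  ... | inj₁ fN≡0 = zeroProduct⇒zeroFactor dom N (suc M) (boundedBy-pred bf fN≡0) bg h
  ... | inj₂ gM≡0 = zeroProduct⇒zeroFactor dom (suc N) M bf (boundedBy-pred bg gM≡0) h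

  infix 4 _≈_
  _≈_ : Poly R → Poly R → Set
  _≈_ = _≈ₚ_ R

  constant : S → Poly R
  constant a = f , 1 , λ { (suc n) _ → refl }
    where
    f : ℕ → S
    f zero    = a
    f (suc _) = zero₀

  zeroP≈oneP⇔0≡1 : zeroP R ≈ oneP R ⇔ zero₀ ≡ one
  zeroP≈oneP⇔0≡1 = mk⇔ (λ e → e 0) λ { e zero → e ; e (suc n) → refl }

  mulP-zeroˡ : ∀ p q → p ≈ zeroP R → mulP R p q (zeroP R)
  mulP-zeroˡ p q p≈0 n = Convolution.0∈convSum (coeff R p) (coeff R q) n (suc n)
    (λ i → subst (λ w → mul w _ zero₀) (sym (p≈0 i)) (0∈0· _))

  mulP-zeroʳ : ∀ p q → q ≈ zeroP R → mulP R p q (zeroP R)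
  mulP-zeroʳ p q q≈0 n = Convolution.0∈convSum (coeff R p) (coeff R q) n (suc n)
    (λ i → subst (λ w → mul _ w zero₀) (sym (q≈0 (n ∸ i))) (0∈·0 _))

  mulP-constant : ∀ a b → mul a b zero₀ → mulP R (constant a) (constant b) (zeroP R)
  mulP-constant a b 0∈ab n = Convolution.0∈convSum _ _ n (suc n) (summand n)
    where
    summand : ∀ n i → mul (coeff R (constant a) i) (coeff R (constant b) (n ∸ i)) zero₀
    summand zero    zero    = 0∈ab
    summand (suc n) zero    = 0∈·0 a
    summand n       (suc i) = 0∈0· _

  polyDomain⇒domain : PolyIsTwoDomain R → IsTwoDomain R
  polyDomain⇒domain (0≉1 , dom) = (λ 0≡1 → 0≉1 (Equivalence.from zeroP≈oneP⇔0≡1 0≡1)) , λ a b → fwd a b , bwd a b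
    where
    fwd : ∀ a b → mul a b zero₀ → a ≡ zero₀ ⊎ b ≡ zero₀
    fwd a b 0∈ab with proj₁ (dom (constant a) (constant b)) (mulP-constant a b 0∈ab)
    ... | inj₁ a≈0 = inj₁ (a≈0 0)
    ... | inj₂ b≈0 = inj₂ (b≈0 0)
    bwd : ∀ a b → a ≡ zero₀ ⊎ b ≡ zero₀ → mul a b zero₀
    bwd a b (inj₁ refl) = 0∈0· b
    bwd a b (inj₂ refl) = 0∈·0 a

  domain⇒polyDomain : IsTwoDomain R → PolyIsTwoDomain R
  domain⇒polyDomain (0≢1 , dom) = (λ 0≈1 → 0≢1 (Equivalence.to zeroP≈oneP⇔0≡1 0≈1)) , λ p q → fwd p q , bwd p q
    where
    fwd : ∀ p q → mulP R p q (zeroP R) → p ≈ zeroP R ⊎ q ≈ zeroP R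
    fwd (f , N , bf) (g , M , bg) = zeroProduct⇒zeroFactor (λ a b → proj₁ (dom a b)) N M bf bg
    bwd : ∀ p q → p ≈ zeroP R ⊎ q ≈ zeroP R → mulP R p q (zeroP R)
    bwd p q (inj₁ p≈0) = mulP-zeroˡ p q p≈0
    bwd p q (inj₂ q≈0) = mulP-zeroʳ p q q≈0

mainTheorem1 : (R : TwoRing) → (PolyIsTwoDomain R → IsTwoDomain R) × (IsTwoDomain R → PolyIsTwoDomain R)
mainTheorem1 R = polyDomain⇒domain R , domain⇒polyDomain R
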